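{- Let $m\geqslant 2$ and $n_1,n_2\geqslant 1$ be integers such that $q_1=1+mn_1$ and $q_2=1+mn_2$ are prime powers, and let $\alpha_1,\alpha_2$ be primitive elements of $\operatorname{GF}(q_1)$, $\operatorname{GF}(q_2)$. Then $\Gamma_m(\alpha_1,\alpha_2)$ has coherent rank at most $m+3$.
   Context: Let $\mathsf C_1(\alpha_1) = \{(\alpha_1^k,0): 0\le k\le q_1-2\}$ and $\mathsf D_0(\alpha_1,\alpha_2) = \{(\alpha_1^{i_1},\alpha_2^{i_2}) : i_1\equiv i_2 \pmod m\}$ in the additive group $\operatorname{GF}(q_1)\times\operatorname{GF}(q_2)$. $\Gamma_m(\alpha_1,\alpha_2)$ is the Cayley (di)graph on this group with connection set $\mathsf C_1(\alpha_1)\cup\mathsf D_0(\alpha_1,\alpha_2)$ (arcs $(g,s+g)$). The coherent rank of a (di)graph is the dimension of its coherent closure, the smallest algebra of complex matrices containing its adjacency matrix, $I$ and $J$, closed under transpose, matrix product and entrywise product. -}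

module Defs where

open import Level using (0ℓ)
open import Data.Nat using (ℕ; zero; suc; _≤_; _∸_; _%_; NonZero)
open import Data.Fin using (Fin)
open import Data.Fin.Properties using (_≟_)
open import Data.List using (List; length; filter; allFin; cartesianProduct)
open import Data.Product using (_×_; _,_; ∃; ∃-syntax; Σ)
open import Data.Sum using (_⊎_)
open import Relation.Nullary using (¬_; Dec; _×-dec_)
open import Relation.Binary.PropositionalEquality using (_≡_; _≢_)
open import Algebra.Structures using (IsCommutativeRing)
open import Data.Nat.Primality using (Prime)
open import Data.Nat renaming (_^_ to _ℕ^_) using ()

-- Finite fields of order q, with carrier Fin q (so |F| = q and equality
-- is decidable propositional equality).

record FiniteField (q : ℕ) : Set where
  field
    _+_ _*_ : Fin q → Fin q → Fin q
    -_      : Fin q → Fin q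
    0# 1#   : Fin q
    isCommutativeRing : IsCommutativeRing _≡_ _+_ _*_ -_ 0# 1#
    0≢1     : 0# ≢ 1#
    inverse : ∀ x → x ≢ 0# → ∃[ y ] (x * y ≡ 1#)

  infixl 7 _*_
  infixl 6 _+_

  _-_ : Fin q → Fin q → Fin q
  x - y = x + (- y)

  _^_ : Fin q → ℕ → Fin q
  x ^ zero  = 1#
  x ^ suc k = x * (x ^ k)

  Primitive : Fin q → Set
  Primitive α = ∀ x → x ≢ 0# → ∃[ k ] (α ^ k ≡ x)

IsPrimePower : ℕ → Set
IsPrimePower q = ∃[ p ] ∃[ e ] (Prime p × 1 ≤ e × q ≡ p ℕ^ e)

-- Coherent configurations on a finite vertex type V, enumerated
-- (without repetition, completely) by the list vs.  A coherent
-- configuration of rank r is a colouring of V × V by r colours (a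
-- partition of V × V into r nonempty relations) such that
--  * the diagonal is a union of colour classes,
--  * the transpose of a colour class is a colour class,
--  * the intersection numbers p^k_{ij} = #{z | c(x,z)=i, c(z,y)=j}
--    depend only on the colour k = c(x,y).

module _ {V : Set} (vs : List V) where

  count : (P : V → Set) → (∀ z → Dec (P z)) → ℕ
  count P P? = length (filter P? vs)

  record CoherentConfiguration (r : ℕ) : Set where
    field
      colour    : V → V → Fin r
      nonempty  : ∀ i → ∃[ x ] ∃[ y ] (colour x y ≡ i)
      diagonal  : ∀ x y z → colour x x ≡ colour y z → y ≡ z
      transpose : ∀ x y x′ y′ → colour x y ≡ colour x′ y′ → colour y x ≡ colour y′ x′
      regular   : ∀ x y x′ y′ → colour x y ≡ colour x′ y′ → ∀ i j →
                  count (λ z → colour x z ≡ i × colour z y ≡ j)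
                        (λ z → (colour x z ≟ i) ×-dec (colour z y ≟ j))
                  ≡ count (λ z → colour x′ z ≡ i × colour z y′ ≡ j)
                          (λ z → (colour x′ z ≟ i) ×-dec (colour z y′ ≟ j))

  _IsUnionOfClassesOf_ : ∀ {r} → (V → V → Set) → CoherentConfiguration r → Set
  R IsUnionOfClassesOf C = ∀ x y x′ y′ → colour x y ≡ colour x′ y′ → R x y → R x′ y′
    where open CoherentConfiguration C

  -- coherent rank of a (di)graph with arc relation R is at most b:
  -- the coherent closure (= the coarsest coherent configuration in which
  -- R is a union of classes) has at most b classes; equivalently some
  -- coherent configuration with at most b classes has R as a union of
  -- classes.
  CoherentRank≤ : (V → V → Set) → ℕ → Set
  CoherentRank≤ R b = ∃[ r ] (r ≤ b × Σ (CoherentConfiguration r) (λ C → R IsUnionOfClassesOf C))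

module _ {q₁ q₂ : ℕ} (F₁ : FiniteField q₁) (F₂ : FiniteField q₂) where
  private
    module F₁ = FiniteField F₁
    module F₂ = FiniteField F₂

  Vertex : Set
  Vertex = Fin q₁ × Fin q₂

  vertices : List Vertex
  vertices = cartesianProduct (allFin q₁) (allFin q₂)

  _⊕_ : Vertex → Vertex → Vertex
  (a , b) ⊕ (c , d) = (a F₁.+ c , b F₂.+ d)

  C₁ : Fin q₁ → Vertex → Set
  C₁ α₁ s = ∃[ k ] (k ≤ q₁ ∸ 2 × s ≡ (α₁ F₁.^ k , F₂.0#))

  D₀ : (m : ℕ) → .{{NonZero m}} → Fin q₁ → Fin q₂ → Vertex → Set
  D₀ m α₁ α₂ s = ∃[ i₁ ] ∃[ i₂ ] (i₁ % m ≡ i₂ % m × s ≡ (α₁ F₁.^ i₁ , α₂ F₂.^ i₂))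

  Γ : (m : ℕ) → .{{NonZero m}} → Fin q₁ → Fin q₂ → Vertex → Vertex → Set
  Γ m α₁ α₂ g h = ∃[ s ] ((C₁ α₁ s ⊎ D₀ m α₁ α₂ s) × h ≡ s ⊕ g)

-- Colour an arc (x, y) of GF(q₁) × GF(q₂) by the orbit of y − x under the multiplier group
-- H = {(h₁, h₂) ∈ GF(q₁)* × GF(q₂)* : ind h₁ ≡ ind h₂ (mod m)}, where ind is the index with
-- respect to α₁, α₂; it is well defined modulo m because α has order q − 1 and m ∣ q − 1.
-- H has m + 3 orbits: {0}, GF(q₁)* × {0}, {0} × GF(q₂)*, and the classes D_j of pairs whose
-- indices differ by j modulo m.  The colour classes are then the orbitals of the affine
-- maps u ↦ h·(u − x) + x′ with h ∈ H, so the colouring is a (Schurian) coherent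
-- configuration of rank m + 3, and C₁ and D₀, being the orbits of (1, 0) and (1, 1),
-- are unions of its classes.

module Submission where

open import Level using (0ℓ)
open import Algebra.Bundles using (CommutativeRing)
import Algebra.Properties.Ring as RingProperties
import Algebra.Properties.Semiring.Exp as SemiringExp
open import Data.Bool using (Bool; true; false)
open import Data.Fin as Fin using (Fin; toℕ; fromℕ<; _↑ʳ_; punchIn; punchOut)
import Data.Fin.Properties as Fin
open import Data.Fin.Properties using (_≟_)
open import Data.List using (List; []; _∷_; map; length)
open import Data.List.Membership.Propositional using (_∈_)
open import Data.List.Membership.Propositional.Properties using (∈-map⁺; ∈-allFin; ∈-cartesianProduct⁺)
open import Data.List.Membership.Propositional.Properties.WithK using (unique∧set⇒bag)
open import Data.List.Properties using (filter-≐)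
open import Data.List.Relation.Binary.BagAndSetEquality using (∼bag⇒↭)
open import Data.List.Relation.Binary.Permutation.Propositional.Properties using (↭-length; filter-↭)
open import Data.List.Relation.Unary.Unique.Propositional using (Unique)
import Data.List.Relation.Unary.Unique.Propositional.Properties as Unique
open import Data.Nat as ℕ using (ℕ; zero; suc; _∸_; _%_; _/_; _≤_; _<_; z≤n; s≤s; NonZero)
import Data.Nat.Properties as ℕ
open import Data.Nat.DivMod
  using (m%n<n; m≡m%n+[m/n]*n; m%n%n≡m%n; [m+n]%n≡m%n; %-distribˡ-+; %-remove-+ʳ; m<n⇒m%n≡m; m∣n⇒o%n%m≡o%m)
open import Data.Nat.Divisibility using (_∣_; m∣m*n; m%n≡0⇒n∣m)
open import Data.Product using (_×_; _,_; proj₁; proj₂; ∃-syntax)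
open import Data.Product.Function.NonDependent.Propositional using (_×-↔_)
open import Data.Sum as Sum using (_⊎_; inj₁; inj₂)
open import Function using (_∘_; _⇔_; mk⇔; Equivalence)
open import Function.Bundles using (_↔_; Inverse; mk↔ₛ′)
open import Relation.Nullary using (¬_; Dec; yes; no; does; _×-dec_; contradiction)
open import Relation.Nullary.Decidable using (does-⇔; dec-true; dec-false)
open import Relation.Unary using (Pred; Decidable; _≐_)
open import Relation.Binary.PropositionalEquality
open import Defs

module _ {V : Set} where

  count-map : (σ : V → V) (xs : List V) {P : Pred V 0ℓ} (P? : Decidable P) →
              count (map σ xs) P P? ≡ count xs (P ∘ σ) (P? ∘ σ)
  count-map σ [] P? = refl
  count-map σ (x ∷ xs) P? with does (P? (σ x))
  ... | true  = cong suc (count-map σ xs P?)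
  ... | false = count-map σ xs P?

  count-cong : (xs : List V) {P Q : Pred V 0ℓ} (P? : Decidable P) (Q? : Decidable Q) →
               P ≐ Q → count xs P P? ≡ count xs Q Q?
  count-cong xs P? Q? P≐Q = cong length (filter-≐ P? Q? P≐Q xs)

  module _ {vs : List V} (vs-unique : Unique vs) (vs-complete : ∀ v → v ∈ vs) where

    count-↔ : (σ : V ↔ V) {P : Pred V 0ℓ} (P? : Decidable P) →
              count vs P P? ≡ count vs (P ∘ Inverse.to σ) (P? ∘ Inverse.to σ)
    count-↔ σ P? = trans (↭-length (filter-↭ P? vs↭σvs)) (count-map to vs P?)
      where
      open Inverse σ
      σvs-complete : ∀ v → v ∈ map to vs
      σvs-complete v = subst (_∈ map to vs) (strictlyInverseˡ v) (∈-map⁺ to (vs-complete (from v)))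
      to-injective : ∀ {x y} → to x ≡ to y → x ≡ y
      to-injective {x} {y} eq = trans (sym (strictlyInverseʳ x)) (trans (cong from eq) (strictlyInverseʳ y))
      vs↭σvs = ∼bag⇒↭ (unique∧set⇒bag vs-unique (Unique.map⁺ to-injective vs-unique)
                         (mk⇔ (λ _ → σvs-complete _) (λ _ → vs-complete _)))


module _ {V : Set} {r : ℕ} (c : V → V → Fin r) where

  PreservesColour : V ↔ V → Set
  PreservesColour σ = ∀ x y → c (Inverse.to σ x) (Inverse.to σ y) ≡ c x y

  orbitalColouring⇒coherent : {vs : List V} → Unique vs → (∀ v → v ∈ vs) →
    (∀ i → ∃[ x ] ∃[ y ] (c x y ≡ i)) →
    (∀ {x y x′ y′} → c x y ≡ c x′ y′ →
      ∃[ σ ] (PreservesColour σ × Inverse.to σ x ≡ x′ × Inverse.to σ y ≡ y′)) →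
    CoherentConfiguration vs r
  orbitalColouring⇒coherent {vs} vs-unique vs-complete surjective transitive = record
    { colour    = c
    ; nonempty  = surjective
    ; diagonal  = diagonal
    ; transpose = transpose
    ; regular   = regular
    }
    where
    diagonal : ∀ x y z → c x x ≡ c y z → y ≡ z
    diagonal x y z eq with transitive eq
    ... | σ , _ , σx≡y , σx≡z = trans (sym σx≡y) σx≡z

    transpose : ∀ x y x′ y′ → c x y ≡ c x′ y′ → c y x ≡ c y′ x′
    transpose x y x′ y′ eq with transitive eq
    ... | σ , preserves , σx≡x′ , σy≡y′ =
      trans (sym (preserves y x)) (cong₂ c σy≡y′ σx≡x′)

    regular : ∀ x y x′ y′ → c x y ≡ c x′ y′ → ∀ i j →
              count vs (λ z → c x z ≡ i × c z y ≡ j) (λ z → (c x z ≟ i) ×-dec (c z y ≟ j))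
              ≡ count vs (λ z → c x′ z ≡ i × c z y′ ≡ j) (λ z → (c x′ z ≟ i) ×-dec (c z y′ ≟ j))
    regular x y x′ y′ eq i j with transitive eq
    ... | σ , preserves , σx≡x′ , σy≡y′ =
      trans (count-cong vs _ _ (moved , unmoved)) (sym (count-↔ vs-unique vs-complete σ _))
      where
      open Inverse σ using (to)
      c-left : ∀ z → c x′ (to z) ≡ c x z
      c-left z = trans (cong (λ w → c w (to z)) (sym σx≡x′)) (preserves x z)
      c-right : ∀ z → c (to z) y′ ≡ c z y
      c-right z = trans (cong (c (to z)) (sym σy≡y′)) (preserves z y)
      moved : ∀ {z} → c x z ≡ i × c z y ≡ j → c x′ (to z) ≡ i × c (to z) y′ ≡ j
      moved {z} (p , q) = trans (c-left z) p , trans (c-right z) q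
      unmoved : ∀ {z} → c x′ (to z) ≡ i × c (to z) y′ ≡ j → c x z ≡ i × c z y ≡ j
      unmoved {z} (p , q) = trans (sym (c-left z)) p , trans (sym (c-right z)) q

module FieldProperties {q : ℕ} (F : FiniteField q) where
  open FiniteField F

  ring : CommutativeRing 0ℓ 0ℓ
  ring = record { isCommutativeRing = isCommutativeRing }

  open CommutativeRing ring public
    using (+-assoc; +-identityˡ; -‿inverseʳ; *-assoc; *-comm; *-identityˡ; *-identityʳ; zeroˡ; zeroʳ; distribˡ)
  open RingProperties (CommutativeRing.ring ring) public
    using (//-rightDividesˡ; //-rightDividesʳ)
  private
    module Exp = SemiringExp (CommutativeRing.semiring ring)

  1≢0 : 1# ≢ 0#
  1≢0 = 0≢1 ∘ sym

  inv : (x : Fin q) → x ≢ 0# → Fin q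
  inv x x≢0 = proj₁ (inverse x x≢0)

  *-inverseʳ : ∀ {x} (x≢0 : x ≢ 0#) → x * inv x x≢0 ≡ 1#
  *-inverseʳ {x} x≢0 = proj₂ (inverse x x≢0)

  *-inverseˡ : ∀ {x} (x≢0 : x ≢ 0#) → inv x x≢0 * x ≡ 1#
  *-inverseˡ {x} x≢0 = trans (*-comm _ x) (*-inverseʳ x≢0)

  *-cancelˡ : ∀ {x} y z → x ≢ 0# → x * y ≡ x * z → y ≡ z
  *-cancelˡ {x} y z x≢0 eq = begin
    y                      ≡⟨ sym (*-identityˡ y) ⟩
    1# * y                 ≡⟨ cong (_* y) (sym (*-inverseˡ x≢0)) ⟩
    inv x x≢0 * x * y      ≡⟨ *-assoc _ x y ⟩
    inv x x≢0 * (x * y)    ≡⟨ cong (inv x x≢0 *_) eq ⟩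
    inv x x≢0 * (x * z)    ≡⟨ sym (*-assoc _ x z) ⟩
    inv x x≢0 * x * z      ≡⟨ cong (_* z) (*-inverseˡ x≢0) ⟩
    1# * z                 ≡⟨ *-identityˡ z ⟩
    z                      ∎
    where open ≡-Reasoning

  *-≡0 : ∀ {x y} → x ≢ 0# → x * y ≡ 0# → y ≡ 0#
  *-≡0 {x} {y} x≢0 xy≡0 = *-cancelˡ y 0# x≢0 (trans xy≡0 (sym (zeroʳ x)))

  *-≢0 : ∀ {x y} → x ≢ 0# → y ≢ 0# → x * y ≢ 0#
  *-≢0 x≢0 y≢0 = y≢0 ∘ *-≡0 x≢0

  *-≡0⇔ : ∀ {x} y → x ≢ 0# → (x * y ≡ 0#) ⇔ (y ≡ 0#)
  *-≡0⇔ {x} y x≢0 = mk⇔ (*-≡0 x≢0) (λ y≡0 → trans (cong (x *_) y≡0) (zeroʳ x))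

  *-inverse-cancel : ∀ {x} y (x≢0 : x ≢ 0#) → y * inv x x≢0 * x ≡ y
  *-inverse-cancel {x} y x≢0 =
    trans (*-assoc y _ x) (trans (cong (y *_) (*-inverseˡ x≢0)) (*-identityʳ y))

  divide : ∀ {x y} → x ≢ 0# → y ≢ 0# → ∃[ h ] (h ≢ 0# × h * x ≡ y)
  divide {x} {y} x≢0 y≢0 = y * inv x x≢0 , h≢0 , *-inverse-cancel y x≢0
    where
    h≢0 : y * inv x x≢0 ≢ 0#
    h≢0 h≡0 = y≢0 (trans (sym (*-inverse-cancel y x≢0)) (trans (cong (_* x) h≡0) (zeroˡ x)))

  ^-homo-* : ∀ x a b → x ^ (a ℕ.+ b) ≡ x ^ a * x ^ b
  ^-homo-* x a b = trans (^≗Exp^ x (a ℕ.+ b))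
    (trans (Exp.^-homo-* x a b) (sym (cong₂ _*_ (^≗Exp^ x a) (^≗Exp^ x b))))
    where
    ^≗Exp^ : ∀ x n → x ^ n ≡ x Exp.^ n
    ^≗Exp^ x zero    = refl
    ^≗Exp^ x (suc n) = cong (x *_) (^≗Exp^ x n)

  x^p≡1⇒x^[n*p]≡1 : ∀ {x p} → x ^ p ≡ 1# → ∀ n → x ^ (n ℕ.* p) ≡ 1#
  x^p≡1⇒x^[n*p]≡1         xᵖ≡1 zero    = refl
  x^p≡1⇒x^[n*p]≡1 {x} {p} xᵖ≡1 (suc n) = begin
    x ^ (p ℕ.+ n ℕ.* p)    ≡⟨ ^-homo-* x p (n ℕ.* p) ⟩
    x ^ p * x ^ (n ℕ.* p)  ≡⟨ cong₂ _*_ xᵖ≡1 (x^p≡1⇒x^[n*p]≡1 xᵖ≡1 n) ⟩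
    1# * 1#                ≡⟨ *-identityˡ 1# ⟩
    1#                     ∎
    where open ≡-Reasoning

  x^p≡1⇒x^k≡x^[k%p] : ∀ {x p} .{{_ : NonZero p}} → x ^ p ≡ 1# → ∀ k → x ^ k ≡ x ^ (k % p)
  x^p≡1⇒x^k≡x^[k%p] {x} {p} xᵖ≡1 k = begin
    x ^ k                                  ≡⟨ cong (x ^_) (m≡m%n+[m/n]*n k p) ⟩
    x ^ (k % p ℕ.+ (k / p) ℕ.* p)          ≡⟨ ^-homo-* x (k % p) _ ⟩
    x ^ (k % p) * x ^ ((k / p) ℕ.* p)      ≡⟨ cong (x ^ (k % p) *_) (x^p≡1⇒x^[n*p]≡1 xᵖ≡1 (k / p)) ⟩
    x ^ (k % p) * 1#                       ≡⟨ *-identityʳ _ ⟩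
    x ^ (k % p)                            ∎
    where open ≡-Reasoning

  ^≢0 : ∀ {x} k → x ≢ 0# → x ^ k ≢ 0#
  ^≢0 zero    x≢0 = 1≢0
  ^≢0 (suc k) x≢0 = *-≢0 x≢0 (^≢0 k x≢0)

  affine : Fin q → Fin q → Fin q → Fin q → Fin q
  affine h x x′ u = h * (u - x) + x′

  affine-base : ∀ h x x′ → affine h x x′ x ≡ x′
  affine-base h x x′ = begin
    h * (x - x) + x′  ≡⟨ cong (λ t → h * t + x′) (-‿inverseʳ x) ⟩
    h * 0# + x′       ≡⟨ cong (_+ x′) (zeroʳ h) ⟩
    0# + x′           ≡⟨ +-identityˡ x′ ⟩
    x′                ∎
    where open ≡-Reasoning

  affine-diff : ∀ h x x′ u v → affine h x x′ v - affine h x x′ u ≡ h * (v - u)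
  affine-diff h x x′ u v = begin
    (h * (v - x) + x′) - w                   ≡⟨ cong (λ t → (h * t + x′) - w) v-x ⟩
    (h * ((v - u) + (u - x)) + x′) - w       ≡⟨ cong (λ t → (t + x′) - w) (distribˡ h _ _) ⟩
    ((h * (v - u) + h * (u - x)) + x′) - w   ≡⟨ cong (_- w) (+-assoc _ _ x′) ⟩
    (h * (v - u) + w) - w                    ≡⟨ //-rightDividesʳ w (h * (v - u)) ⟩
    h * (v - u)                              ∎
    where
    open ≡-Reasoning
    w = affine h x x′ u
    v-x : v - x ≡ (v - u) + (u - x)
    v-x = sym (trans (sym (+-assoc (v - u) u (- x))) (cong (_- x) (//-rightDividesˡ u v)))

  affine-inverse : ∀ {h h′} → h * h′ ≡ 1# → ∀ x x′ v → affine h x x′ (affine h′ x′ x v) ≡ v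
  affine-inverse {h} {h′} hh′≡1 x x′ v = begin
    h * ((h′ * (v - x′) + x) - x) + x′   ≡⟨ cong (λ t → h * t + x′) (//-rightDividesʳ x _) ⟩
    h * (h′ * (v - x′)) + x′             ≡⟨ cong (_+ x′) (sym (*-assoc h h′ _)) ⟩
    h * h′ * (v - x′) + x′               ≡⟨ cong (λ t → t * (v - x′) + x′) hh′≡1 ⟩
    1# * (v - x′) + x′                   ≡⟨ cong (_+ x′) (*-identityˡ _) ⟩
    (v - x′) + x′                        ≡⟨ //-rightDividesˡ x′ v ⟩
    v                                    ∎
    where open ≡-Reasoning

  affine↔ : ∀ {h} → h ≢ 0# → Fin q → Fin q → Fin q ↔ Fin q
  affine↔ {h} h≢0 x x′ = mk↔ₛ′ (affine h x x′) (affine (inv h h≢0) x′ x)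
    (affine-inverse (*-inverseʳ h≢0) x x′) (affine-inverse (*-inverseˡ h≢0) x′ x)

infix 4 _≡_mod_
_≡_mod_ : ℕ → ℕ → (m : ℕ) → .{{NonZero m}} → Set
_≡_mod_ i j m = i % m ≡ j % m

module Modular (m : ℕ) .{{_ : NonZero m}} where
  open import Data.Nat using (_+_)
  open import Algebra.Properties.CommutativeSemigroup ℕ.+-commutativeSemigroup using (x∙yz≈y∙xz)

  %-mod : ∀ i → i % m ≡ i mod m
  %-mod i = m%n%n≡m%n i m

  +-cong-mod : ∀ {i i′ j j′} → i ≡ i′ mod m → j ≡ j′ mod m → i + j ≡ i′ + j′ mod m
  +-cong-mod {i} {i′} {j} {j′} i≡i′ j≡j′ = begin
    (i + j) % m              ≡⟨ %-distribˡ-+ i j m ⟩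
    (i % m + j % m) % m      ≡⟨ cong₂ (λ s t → (s + t) % m) i≡i′ j≡j′ ⟩
    (i′ % m + j′ % m) % m    ≡⟨ sym (%-distribˡ-+ i′ j′ m) ⟩
    (i′ + j′) % m            ∎
    where open ≡-Reasoning

  +-cancelʳ-mod : ∀ i j k → i + k ≡ j + k mod m → i ≡ j mod m
  +-cancelʳ-mod i j k eq = trans (sym (+-negate i)) (trans (+-cong-mod eq refl) (+-negate j))
    where
    +-negate : ∀ i → (i + k) + (m ∸ k % m) ≡ i mod m
    +-negate i = begin
      ((i + k) + (m ∸ k % m)) % m        ≡⟨ +-cong-mod (+-cong-mod {i} refl (%-mod k)) refl ⟨
      ((i + k % m) + (m ∸ k % m)) % m    ≡⟨ cong (_% m) (ℕ.+-assoc i (k % m) _) ⟩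
      (i + (k % m + (m ∸ k % m))) % m    ≡⟨ cong (λ t → (i + t) % m) (ℕ.m+[n∸m]≡n (ℕ.<⇒≤ (m%n<n k m))) ⟩
      (i + m) % m                        ≡⟨ [m+n]%n≡m%n i m ⟩
      i % m                              ∎
      where open ≡-Reasoning

  <-mod-injective : ∀ {i j} → i < m → j < m → i ≡ j mod m → i ≡ j
  <-mod-injective i<m j<m eq = trans (sym (m<n⇒m%n≡m i<m)) (trans eq (m<n⇒m%n≡m j<m))

  difference : ℕ → ℕ → Fin m
  difference i j = fromℕ< (m%n<n (i + (m ∸ j % m)) m)

  difference-spec : ∀ i j → toℕ (difference i j) + j ≡ i mod m
  difference-spec i j = begin
    (toℕ (difference i j) + j) % m    ≡⟨ +-cong-mod (trans (cong (_% m) (Fin.toℕ-fromℕ< _)) (%-mod _)) (sym (%-mod j)) ⟩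
    ((i + (m ∸ j % m)) + j % m) % m   ≡⟨ cong (_% m) (ℕ.+-assoc i _ (j % m)) ⟩
    (i + ((m ∸ j % m) + j % m)) % m   ≡⟨ cong (λ t → (i + t) % m) (ℕ.m∸n+n≡m (ℕ.<⇒≤ (m%n<n j m))) ⟩
    (i + m) % m                       ≡⟨ [m+n]%n≡m%n i m ⟩
    i % m                             ∎
    where open ≡-Reasoning

  difference-unique : ∀ {i j} (t : Fin m) → toℕ t + j ≡ i mod m → difference i j ≡ t
  difference-unique {i} {j} t t+j≡i = Fin.toℕ-injective (<-mod-injective (Fin.toℕ<n _) (Fin.toℕ<n t)
    (+-cancelʳ-mod _ _ j (trans (difference-spec i j) (sym t+j≡i))))

  difference-cong : ∀ {i i′ j j′} → i ≡ i′ mod m → j ≡ j′ mod m → difference i j ≡ difference i′ j′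
  difference-cong {i} {i′} {j} {j′} i≡i′ j≡j′ = difference-unique (difference i′ j′)
    (trans (+-cong-mod {toℕ (difference i′ j′)} refl j≡j′) (trans (difference-spec i′ j′) (sym i≡i′)))

  difference-shift : ∀ {k l} i j → k ≡ l mod m → difference (k + i) (l + j) ≡ difference i j
  difference-shift {k} {l} i j k≡l = difference-unique (difference i j) (begin
    (toℕ (difference i j) + (l + j)) % m   ≡⟨ cong (_% m) (x∙yz≈y∙xz (toℕ (difference i j)) l j) ⟩
    (l + (toℕ (difference i j) + j)) % m   ≡⟨ +-cong-mod (sym k≡l) (difference-spec i j) ⟩
    (k + i) % m                            ∎)
    where open ≡-Reasoning

  difference-shift⁻¹ : ∀ {k l} i j → difference (k + i) (l + j) ≡ difference i j → k ≡ l mod m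
  difference-shift⁻¹ {k} {l} i j eq = sym (+-cancelʳ-mod l k (t + j) (begin
    (l + (t + j)) % m   ≡⟨ cong (_% m) (x∙yz≈y∙xz t l j) ⟨
    (t + (l + j)) % m   ≡⟨ cong (λ s → (toℕ s + (l + j)) % m) eq ⟨
    (toℕ (difference (k + i) (l + j)) + (l + j)) % m   ≡⟨ difference-spec (k + i) (l + j) ⟩
    (k + i) % m         ≡⟨ +-cong-mod {k} refl (difference-spec i j) ⟨
    (k + (t + j)) % m   ∎))
    where
    open ≡-Reasoning
    t = toℕ (difference i j)

module PrimitiveElement {N : ℕ} (F : FiniteField (suc N)) (2≤N : 2 ≤ N)
                        {α : Fin (suc N)} (α-primitive : FiniteField.Primitive F α) where
  open FiniteField F
  open FieldProperties F

  private instance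
    N-nonZero : NonZero N
    N-nonZero = ℕ.>-nonZero (ℕ.≤-trans (s≤s z≤n) 2≤N)

  -- Otherwise every nonzero element would be α⁰ = 1, leaving at most two elements.
  α≢0 : α ≢ 0#
  α≢0 α≡0 = ℕ.<⇒≱ (s≤s 2≤N) (Fin.injective⇒≤ isZero-injective)
    where
    nonzero⇒≡1 : ∀ {x} → x ≢ 0# → x ≡ 1#
    nonzero⇒≡1 {x} x≢0 with α-primitive x x≢0
    ... | zero  , 1≡x    = sym 1≡x
    ... | suc k , αᵏ⁺¹≡x = contradiction (trans (sym αᵏ⁺¹≡x) (trans (cong (_* (α ^ k)) α≡0) (zeroˡ _))) x≢0
    isZero : Fin (suc N) → Fin 2
    isZero x with x ≟ 0#
    ... | yes _ = Fin.zero
    ... | no  _ = Fin.suc Fin.zero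
    isZero-injective : ∀ {x y} → isZero x ≡ isZero y → x ≡ y
    isZero-injective {x} {y} eq with x ≟ 0# | y ≟ 0#
    ... | yes x≡0 | yes y≡0 = trans x≡0 (sym y≡0)
    ... | no  x≢0 | no  y≢0 = trans (nonzero⇒≡1 x≢0) (sym (nonzero⇒≡1 y≢0))
    isZero-injective () | yes _ | no _
    isZero-injective () | no _  | yes _

  αᵏ≢0 : ∀ k → α ^ k ≢ 0#
  αᵏ≢0 k = ^≢0 k α≢0

  0≢αᵏ : ∀ k → 0# ≢ α ^ k
  0≢αᵏ k = αᵏ≢0 k ∘ sym

  α^[a+c]≡α^a⇒α^c≡1 : ∀ a c → α ^ (a ℕ.+ c) ≡ α ^ a → α ^ c ≡ 1#
  α^[a+c]≡α^a⇒α^c≡1 a c eq = *-cancelˡ (α ^ c) 1# (αᵏ≢0 a)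
    (trans (sym (^-homo-* α a c)) (trans eq (sym (*-identityʳ _))))

  period-exists : ∃[ p ] (0 < p × p ≤ N × α ^ p ≡ 1#)
  period-exists with Fin.pigeonhole (ℕ.n<1+n N) (λ i → punchOut (0≢αᵏ (toℕ i)))
  ... | i , j , i<j , eq = toℕ j ∸ toℕ i , ℕ.m<n⇒0<n∸m i<j ,
    ℕ.≤-trans (ℕ.m∸n≤m (toℕ j) (toℕ i)) (ℕ.≤-pred (Fin.toℕ<n j)) ,
    α^[a+c]≡α^a⇒α^c≡1 (toℕ i) _
      (trans (cong (α ^_) (ℕ.m+[n∸m]≡n (ℕ.<⇒≤ i<j)))
             (sym (Fin.punchOut-injective (0≢αᵏ (toℕ i)) (0≢αᵏ (toℕ j)) eq)))

  N≤period : ∀ {p} .{{_ : NonZero p}} → α ^ p ≡ 1# → N ≤ p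
  N≤period {p} αᵖ≡1 = Fin.injective⇒≤ residue-injective
    where
    nonzero : Fin N → Fin (suc N)
    nonzero = punchIn 0#
    nonzero≢0 : ∀ y → nonzero y ≢ 0#
    nonzero≢0 = Fin.punchInᵢ≢i 0#
    index : Fin N → ℕ
    index y = proj₁ (α-primitive (nonzero y) (nonzero≢0 y))
    α^index : ∀ y → α ^ (index y % p) ≡ nonzero y
    α^index y = trans (sym (x^p≡1⇒x^k≡x^[k%p] αᵖ≡1 (index y))) (proj₂ (α-primitive (nonzero y) (nonzero≢0 y)))
    residue : Fin N → Fin p
    residue y = fromℕ< (m%n<n (index y) p)
    residue-injective : ∀ {y y′} → residue y ≡ residue y′ → y ≡ y′
    residue-injective {y} {y′} eq = Fin.punchIn-injective 0# y y′ (begin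
      nonzero y           ≡⟨ sym (α^index y) ⟩
      α ^ (index y % p)   ≡⟨ cong (α ^_) (Fin.fromℕ<-injective _ _ _ _ eq) ⟩
      α ^ (index y′ % p)  ≡⟨ α^index y′ ⟩
      nonzero y′          ∎)
      where open ≡-Reasoning

  α^N≡1 : α ^ N ≡ 1#
  α^N≡1 with period-exists
  ... | p , 0<p , p≤N , αᵖ≡1 =
    subst (λ n → α ^ n ≡ 1#) (ℕ.≤-antisym p≤N (N≤period {{ℕ.>-nonZero 0<p}} αᵖ≡1)) αᵖ≡1

  α^c≡1⇒N∣c : ∀ {c} → α ^ c ≡ 1# → N ∣ c
  α^c≡1⇒N∣c {c} αᶜ≡1 = m%n≡0⇒n∣m c N (c%N≡0 (c % N) α^[c%N]≡1 (m%n<n c N))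
    where
    α^[c%N]≡1 : α ^ (c % N) ≡ 1#
    α^[c%N]≡1 = trans (sym (x^p≡1⇒x^k≡x^[k%p] α^N≡1 c)) αᶜ≡1
    c%N≡0 : ∀ r → α ^ r ≡ 1# → r < N → r ≡ 0
    c%N≡0 zero    _    _   = refl
    c%N≡0 (suc r) αʳ≡1 r<N = contradiction (N≤period αʳ≡1) (ℕ.<⇒≱ r<N)

  ^-injective-mod-≤ : ∀ {a b} → a ≤ b → α ^ b ≡ α ^ a → b % N ≡ a % N
  ^-injective-mod-≤ {a} {b} a≤b eq = begin
    b % N                 ≡⟨ cong (_% N) (sym a+[b∸a]≡b) ⟩
    (a ℕ.+ (b ∸ a)) % N   ≡⟨ %-remove-+ʳ a (α^c≡1⇒N∣c α^[b∸a]≡1) ⟩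
    a % N                 ∎
    where
    open ≡-Reasoning
    a+[b∸a]≡b : a ℕ.+ (b ∸ a) ≡ b
    a+[b∸a]≡b = ℕ.m+[n∸m]≡n a≤b
    α^[b∸a]≡1 : α ^ (b ∸ a) ≡ 1#
    α^[b∸a]≡1 = α^[a+c]≡α^a⇒α^c≡1 a _ (trans (cong (α ^_) a+[b∸a]≡b) eq)

  ^-injective-mod : ∀ {a b} → α ^ a ≡ α ^ b → a % N ≡ b % N
  ^-injective-mod {a} {b} eq with ℕ.≤-total a b
  ... | inj₁ a≤b = sym (^-injective-mod-≤ a≤b (sym eq))
  ... | inj₂ b≤a = ^-injective-mod-≤ b≤a eq

  power-below-N : ∀ {x} → x ≢ 0# → ∃[ k ] (k < N × α ^ k ≡ x)
  power-below-N {x} x≢0 with α-primitive x x≢0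
  ... | k , αᵏ≡x = k % N , m%n<n k N , trans (sym (x^p≡1⇒x^k≡x^[k%p] α^N≡1 k)) αᵏ≡x

  module IndexModulo (m : ℕ) .{{_ : NonZero m}} (m∣N : m ∣ N) where
    open Modular m

    -- ρ x is the index of x modulo m, with junk value 0 at 0#.  It is opaque so that
    -- with-abstractions over x ≟ 0# in later proofs do not reach inside it.
    opaque
      ρ : Fin (suc N) → ℕ
      ρ x with x ≟ 0#
      ... | yes _   = 0
      ... | no  x≢0 = proj₁ (α-primitive x x≢0) % m

      ρ<m : ∀ x → ρ x < m
      ρ<m x with x ≟ 0#
      ... | yes _ = ℕ.>-nonZero⁻¹ m
      ... | no  _ = m%n<n _ m

      ρ-index : ∀ {x} k → α ^ k ≡ x → ρ x ≡ k % m
      ρ-index {x} k αᵏ≡x with x ≟ 0#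
      ... | yes x≡0 = contradiction (trans αᵏ≡x x≡0) (αᵏ≢0 k)
      ... | no  x≢0 with α-primitive x x≢0
      ...   | i , αⁱ≡x = begin
        i % m      ≡⟨ sym (m∣n⇒o%n%m≡o%m m N i m∣N) ⟩
        i % N % m  ≡⟨ cong (_% m) (^-injective-mod (trans αⁱ≡x (sym αᵏ≡x))) ⟩
        k % N % m  ≡⟨ m∣n⇒o%n%m≡o%m m N k m∣N ⟩
        k % m      ∎
        where open ≡-Reasoning

    ρ-index-mod : ∀ {x} k → α ^ k ≡ x → ρ x ≡ k mod m
    ρ-index-mod k αᵏ≡x = trans (cong (_% m) (ρ-index k αᵏ≡x)) (%-mod k)

    ρ-* : ∀ {x y} → x ≢ 0# → y ≢ 0# → ρ (x * y) ≡ ρ x ℕ.+ ρ y mod m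
    ρ-* {x} {y} x≢0 y≢0 with α-primitive x x≢0 | α-primitive y y≢0
    ... | i , αⁱ≡x | j , αʲ≡y = begin
      ρ (x * y) % m          ≡⟨ cong (_% m) (ρ-index (i ℕ.+ j) αⁱ⁺ʲ≡xy) ⟩
      (i ℕ.+ j) % m % m      ≡⟨ %-mod (i ℕ.+ j) ⟩
      (i ℕ.+ j) % m          ≡⟨ +-cong-mod (ρ-index-mod i αⁱ≡x) (ρ-index-mod j αʲ≡y) ⟨
      (ρ x ℕ.+ ρ y) % m      ∎
      where
      open ≡-Reasoning
      αⁱ⁺ʲ≡xy : α ^ (i ℕ.+ j) ≡ x * y
      αⁱ⁺ʲ≡xy = trans (^-homo-* α i j) (cong₂ _*_ αⁱ≡x αʲ≡y)

module _ {q₁ q₂ : ℕ} (F₁ : FiniteField q₁) (F₂ : FiniteField q₂) where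

  vertices-unique : Unique (vertices F₁ F₂)
  vertices-unique = Unique.cartesianProduct⁺ (Unique.allFin⁺ q₁) (Unique.allFin⁺ q₂)

  vertices-complete : ∀ v → v ∈ vertices F₁ F₂
  vertices-complete (a , b) = ∈-cartesianProduct⁺ (∈-allFin a) (∈-allFin b)

module Γ-Configuration
  (m : ℕ) .{{_ : NonZero m}} {N₁ N₂ : ℕ}
  (F₁ : FiniteField (suc N₁)) (F₂ : FiniteField (suc N₂))
  (2≤N₁ : 2 ≤ N₁) (2≤N₂ : 2 ≤ N₂) (m∣N₁ : m ∣ N₁) (m∣N₂ : m ∣ N₂)
  {α₁ : Fin (suc N₁)} {α₂ : Fin (suc N₂)}
  (α₁-primitive : FiniteField.Primitive F₁ α₁) (α₂-primitive : FiniteField.Primitive F₂ α₂)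
  where

  private
    module F₁ where
      open FiniteField F₁ public
      open FieldProperties F₁ public
      open PrimitiveElement F₁ 2≤N₁ α₁-primitive public
      open IndexModulo m m∣N₁ public
    module F₂ where
      open FiniteField F₂ public
      open FieldProperties F₂ public
      open PrimitiveElement F₂ 2≤N₂ α₂-primitive public
      open IndexModulo m m∣N₂ public
  open Modular m

  V : Set
  V = Vertex F₁ F₂

  _⊖_ : V → V → V
  (a , b) ⊖ (c , d) = (a F₁.- c , b F₂.- d)

  _·_ : V → V → V
  (a , b) · (c , d) = (a F₁.* c , b F₂.* d)

  ⊕-⊖-cancelʳ : ∀ s x → _⊕_ F₁ F₂ s x ⊖ x ≡ s
  ⊕-⊖-cancelʳ (s₁ , s₂) (x₁ , x₂) = cong₂ _,_ (F₁.//-rightDividesʳ x₁ s₁) (F₂.//-rightDividesʳ x₂ s₂)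

  ⊖-⊕-cancelʳ : ∀ x y → _⊕_ F₁ F₂ (y ⊖ x) x ≡ y
  ⊖-⊕-cancelʳ (x₁ , x₂) (y₁ , y₂) = cong₂ _,_ (F₁.//-rightDividesˡ x₁ y₁) (F₂.//-rightDividesˡ x₂ y₂)

  H : Pred V 0ℓ
  H (h₁ , h₂) = h₁ ≢ F₁.0# × h₂ ≢ F₂.0# × F₁.ρ h₁ ≡ F₂.ρ h₂

  D-index : V → Fin m
  D-index (a , b) = difference (F₁.ρ a) (F₂.ρ b)

  -- Colours of the orbits of H: 0, 1 and 2 for {0}, GF(q₁)* × {0} and {0} × GF(q₂)*,
  -- and 3 + j for the class D_j.
  classify : Bool → Bool → Fin m → Fin (3 ℕ.+ m)
  classify true  true  _ = Fin.zero
  classify false true  _ = Fin.suc Fin.zero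
  classify true  false _ = Fin.suc (Fin.suc Fin.zero)
  classify false false j = 3 ↑ʳ j

  κ : V → Fin (3 ℕ.+ m)
  κ (a , b) = classify (does (a ≟ F₁.0#)) (does (b ≟ F₂.0#)) (D-index (a , b))

  classify-congʳ : ∀ {A B : Set} (a? : Dec A) (b? : Dec B) {j j′} → (¬ A → ¬ B → j ≡ j′) →
                   classify (does a?) (does b?) j ≡ classify (does a?) (does b?) j′
  classify-congʳ (yes _) (yes _) _ = refl
  classify-congʳ (no  _) (yes _) _ = refl
  classify-congʳ (yes _) (no  _) _ = refl
  classify-congʳ (no ¬a) (no ¬b) j≡j′ = cong (3 ↑ʳ_) (j≡j′ ¬a ¬b)

  D-index-· : ∀ {h₁ h₂ a b} → h₁ ≢ F₁.0# → h₂ ≢ F₂.0# → a ≢ F₁.0# → b ≢ F₂.0# →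
        D-index ((h₁ , h₂) · (a , b)) ≡ difference (F₁.ρ h₁ ℕ.+ F₁.ρ a) (F₂.ρ h₂ ℕ.+ F₂.ρ b)
  D-index-· h₁≢0 h₂≢0 a≢0 b≢0 = difference-cong (F₁.ρ-* h₁≢0 a≢0) (F₂.ρ-* h₂≢0 b≢0)

  κ-invariant : ∀ {h} → H h → ∀ d → κ (h · d) ≡ κ d
  κ-invariant {h₁ , h₂} (h₁≢0 , h₂≢0 , ρh₁≡ρh₂) (a , b) = begin
    classify (does (h₁ F₁.* a ≟ F₁.0#)) (does (h₂ F₂.* b ≟ F₂.0#)) (D-index ((h₁ , h₂) · (a , b)))
      ≡⟨ cong₂ (λ p q → classify p q (D-index ((h₁ , h₂) · (a , b))))
               (does-⇔ (F₁.*-≡0⇔ a h₁≢0) (h₁ F₁.* a ≟ F₁.0#) (a ≟ F₁.0#))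
               (does-⇔ (F₂.*-≡0⇔ b h₂≢0) (h₂ F₂.* b ≟ F₂.0#) (b ≟ F₂.0#)) ⟩
    classify (does (a ≟ F₁.0#)) (does (b ≟ F₂.0#)) (D-index ((h₁ , h₂) · (a , b)))
      ≡⟨ classify-congʳ (a ≟ F₁.0#) (b ≟ F₂.0#) D-index-invariant ⟩
    classify (does (a ≟ F₁.0#)) (does (b ≟ F₂.0#)) (D-index (a , b))   ∎
    where
    open ≡-Reasoning
    D-index-invariant : a ≢ F₁.0# → b ≢ F₂.0# → D-index ((h₁ , h₂) · (a , b)) ≡ D-index (a , b)
    D-index-invariant a≢0 b≢0 = trans (D-index-· h₁≢0 h₂≢0 a≢0 b≢0)
      (difference-shift (F₁.ρ a) (F₂.ρ b) (cong (_% m) ρh₁≡ρh₂))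

  H-one : H (F₁.1# , F₂.1#)
  H-one = F₁.1≢0 , F₂.1≢0 , trans (F₁.ρ-index 0 refl) (sym (F₂.ρ-index 0 refl))

  H-lift₁ : ∀ {h₁} → h₁ ≢ F₁.0# → ∃[ h₂ ] H (h₁ , h₂)
  H-lift₁ {h₁} h₁≢0 = α₂ F₂.^ F₁.ρ h₁ , h₁≢0 , F₂.αᵏ≢0 (F₁.ρ h₁) ,
    sym (trans (F₂.ρ-index (F₁.ρ h₁) refl) (m<n⇒m%n≡m (F₁.ρ<m h₁)))

  H-lift₂ : ∀ {h₂} → h₂ ≢ F₂.0# → ∃[ h₁ ] H (h₁ , h₂)
  H-lift₂ {h₂} h₂≢0 = α₁ F₁.^ F₂.ρ h₂ , F₁.αᵏ≢0 (F₂.ρ h₂) , h₂≢0 ,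
    trans (F₁.ρ-index (F₂.ρ h₂) refl) (m<n⇒m%n≡m (F₂.ρ<m h₂))

  D-index-transitive : ∀ {a b a′ b′} → a ≢ F₁.0# → b ≢ F₂.0# → a′ ≢ F₁.0# → b′ ≢ F₂.0# →
                       D-index (a , b) ≡ D-index (a′ , b′) → ∃[ h ] (H h × h · (a , b) ≡ (a′ , b′))
  D-index-transitive {a} {b} {a′} {b′} a≢0 b≢0 a′≢0 b′≢0 eq
    with F₁.divide a≢0 a′≢0 | F₂.divide b≢0 b′≢0
  ... | h₁ , h₁≢0 , h₁a≡a′ | h₂ , h₂≢0 , h₂b≡b′ =
    (h₁ , h₂) , (h₁≢0 , h₂≢0 , ρh₁≡ρh₂) , h·d≡d′
    where
    h·d≡d′ : (h₁ , h₂) · (a , b) ≡ (a′ , b′)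
    h·d≡d′ = cong₂ _,_ h₁a≡a′ h₂b≡b′
    ρh₁≡ρh₂ : F₁.ρ h₁ ≡ F₂.ρ h₂
    ρh₁≡ρh₂ = <-mod-injective (F₁.ρ<m h₁) (F₂.ρ<m h₂) (difference-shift⁻¹ (F₁.ρ a) (F₂.ρ b) (begin
      difference (F₁.ρ h₁ ℕ.+ F₁.ρ a) (F₂.ρ h₂ ℕ.+ F₂.ρ b)  ≡⟨ D-index-· h₁≢0 h₂≢0 a≢0 b≢0 ⟨
      D-index ((h₁ , h₂) · (a , b))                        ≡⟨ cong D-index h·d≡d′ ⟩
      D-index (a′ , b′)                                    ≡⟨ eq ⟨
      D-index (a , b)                                      ∎))
      where open ≡-Reasoning

  κ-transitive : ∀ d d′ → κ d ≡ κ d′ → ∃[ h ] (H h × h · d ≡ d′)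
  κ-transitive (a , b) (a′ , b′) with a ≟ F₁.0# | b ≟ F₂.0# | a′ ≟ F₁.0# | b′ ≟ F₂.0#
  ... | yes refl | yes refl | yes refl | yes refl = λ _ →
    (F₁.1# , F₂.1#) , H-one , cong₂ _,_ (F₁.zeroʳ F₁.1#) (F₂.zeroʳ F₂.1#)
  ... | no a≢0 | yes refl | no a′≢0 | yes refl = λ _ → axis₁ (F₁.divide a≢0 a′≢0)
    where
    axis₁ : ∃[ h₁ ] (h₁ ≢ F₁.0# × h₁ F₁.* a ≡ a′) → ∃[ h ] (H h × h · (a , F₂.0#) ≡ (a′ , F₂.0#))
    axis₁ (h₁ , h₁≢0 , h₁a≡a′) with H-lift₁ h₁≢0
    ... | h₂ , h∈H = (h₁ , h₂) , h∈H , cong₂ _,_ h₁a≡a′ (F₂.zeroʳ h₂)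
  ... | yes refl | no b≢0 | yes refl | no b′≢0 = λ _ → axis₂ (F₂.divide b≢0 b′≢0)
    where
    axis₂ : ∃[ h₂ ] (h₂ ≢ F₂.0# × h₂ F₂.* b ≡ b′) → ∃[ h ] (H h × h · (F₁.0# , b) ≡ (F₁.0# , b′))
    axis₂ (h₂ , h₂≢0 , h₂b≡b′) with H-lift₂ h₂≢0
    ... | h₁ , h∈H = (h₁ , h₂) , h∈H , cong₂ _,_ (F₁.zeroʳ h₁) h₂b≡b′
  ... | no a≢0 | no b≢0 | no a′≢0 | no b′≢0 =
    D-index-transitive a≢0 b≢0 a′≢0 b′≢0 ∘ Fin.↑ʳ-injective 3 _ _
  ... | yes _ | yes _ | yes _ | no  _ = λ ()
  ... | yes _ | yes _ | no  _ | yes _ = λ ()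
  ... | yes _ | yes _ | no  _ | no  _ = λ ()
  ... | yes _ | no  _ | yes _ | yes _ = λ ()
  ... | yes _ | no  _ | no  _ | yes _ = λ ()
  ... | yes _ | no  _ | no  _ | no  _ = λ ()
  ... | no  _ | yes _ | yes _ | yes _ = λ ()
  ... | no  _ | yes _ | yes _ | no  _ = λ ()
  ... | no  _ | yes _ | no  _ | no  _ = λ ()
  ... | no  _ | no  _ | yes _ | yes _ = λ ()
  ... | no  _ | no  _ | yes _ | no  _ = λ ()
  ... | no  _ | no  _ | no  _ | yes _ = λ ()

  κ≡classify : ∀ a b {p q} → does (a ≟ F₁.0#) ≡ p → does (b ≟ F₂.0#) ≡ q →
                  κ (a , b) ≡ classify p q (D-index (a , b))
  κ≡classify a b = cong₂ (λ p q → classify p q (D-index (a , b)))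

  κ-surjective : ∀ i → ∃[ d ] (κ d ≡ i)
  κ-surjective Fin.zero = (F₁.0# , F₂.0#) ,
    κ≡classify F₁.0# F₂.0# (dec-true (F₁.0# ≟ F₁.0#) refl) (dec-true (F₂.0# ≟ F₂.0#) refl)
  κ-surjective (Fin.suc Fin.zero) = (F₁.1# , F₂.0#) ,
    κ≡classify F₁.1# F₂.0# (dec-false (F₁.1# ≟ F₁.0#) F₁.1≢0) (dec-true (F₂.0# ≟ F₂.0#) refl)
  κ-surjective (Fin.suc (Fin.suc Fin.zero)) = (F₁.0# , F₂.1#) ,
    κ≡classify F₁.0# F₂.1# (dec-true (F₁.0# ≟ F₁.0#) refl) (dec-false (F₂.1# ≟ F₂.0#) F₂.1≢0)
  κ-surjective (Fin.suc (Fin.suc (Fin.suc j))) = (α₁ F₁.^ toℕ j , F₂.1#) , trans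
    (κ≡classify (α₁ F₁.^ toℕ j) F₂.1#
      (dec-false (_ ≟ F₁.0#) (F₁.αᵏ≢0 (toℕ j))) (dec-false (F₂.1# ≟ F₂.0#) F₂.1≢0))
    (cong (3 ↑ʳ_) D-index≡j)
    where
    D-index≡j : D-index (α₁ F₁.^ toℕ j , F₂.1#) ≡ j
    D-index≡j = trans (difference-cong (F₁.ρ-index-mod (toℕ j) refl) (F₂.ρ-index-mod 0 refl))
                      (difference-unique j (cong (_% m) (ℕ.+-identityʳ (toℕ j))))

  colour : V → V → Fin (3 ℕ.+ m)
  colour x y = κ (y ⊖ x)

  colour-surjective : ∀ i → ∃[ x ] ∃[ y ] (colour x y ≡ i)
  colour-surjective i with κ-surjective i
  ... | d , κd≡i = (F₁.0# , F₂.0#) , _⊕_ F₁ F₂ d (F₁.0# , F₂.0#) ,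
    trans (cong κ (⊕-⊖-cancelʳ d _)) κd≡i

  affine↔ : ∀ {h} → H h → V → V → V ↔ V
  affine↔ (h₁≢0 , h₂≢0 , _) (x₁ , x₂) (x₁′ , x₂′) =
    F₁.affine↔ h₁≢0 x₁ x₁′ ×-↔ F₂.affine↔ h₂≢0 x₂ x₂′

  colour-transitive : ∀ {x y x′ y′} → colour x y ≡ colour x′ y′ →
    ∃[ σ ] (PreservesColour colour σ × Inverse.to σ x ≡ x′ × Inverse.to σ y ≡ y′)
  colour-transitive {x₁ , x₂} {y₁ , y₂} {x₁′ , x₂′} {y₁′ , y₂′} eq
    with κ-transitive ((y₁ , y₂) ⊖ (x₁ , x₂)) ((y₁′ , y₂′) ⊖ (x₁′ , x₂′)) eq
  ... | (h₁ , h₂) , h∈H , h[y-x]≡y′-x′ =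
    affine↔ h∈H (x₁ , x₂) (x₁′ , x₂′) , preserves , σx≡x′ , σy≡y′
    where
    preserves : PreservesColour colour (affine↔ h∈H (x₁ , x₂) (x₁′ , x₂′))
    preserves (u₁ , u₂) (v₁ , v₂) = trans
      (cong κ (cong₂ _,_ (F₁.affine-diff h₁ x₁ x₁′ u₁ v₁) (F₂.affine-diff h₂ x₂ x₂′ u₂ v₂)))
      (κ-invariant h∈H ((v₁ , v₂) ⊖ (u₁ , u₂)))
    σx≡x′ : (F₁.affine h₁ x₁ x₁′ x₁ , F₂.affine h₂ x₂ x₂′ x₂) ≡ (x₁′ , x₂′)
    σx≡x′ = cong₂ _,_ (F₁.affine-base h₁ x₁ x₁′) (F₂.affine-base h₂ x₂ x₂′)
    σy≡y′ : (F₁.affine h₁ x₁ x₁′ y₁ , F₂.affine h₂ x₂ x₂′ y₂) ≡ (y₁′ , y₂′)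
    σy≡y′ = trans (cong (λ d → _⊕_ F₁ F₂ d (x₁′ , x₂′)) h[y-x]≡y′-x′)
                  (⊖-⊕-cancelʳ (x₁′ , x₂′) (y₁′ , y₂′))

  coherentConfiguration : CoherentConfiguration (vertices F₁ F₂) (3 ℕ.+ m)
  coherentConfiguration = orbitalColouring⇒coherent colour
    (vertices-unique F₁ F₂) (vertices-complete F₁ F₂) colour-surjective colour-transitive

  H-powers : ∀ i₁ i₂ → i₁ ≡ i₂ mod m → H (α₁ F₁.^ i₁ , α₂ F₂.^ i₂)
  H-powers i₁ i₂ i₁≡i₂ = F₁.αᵏ≢0 i₁ , F₂.αᵏ≢0 i₂ ,
    trans (F₁.ρ-index i₁ refl) (trans i₁≡i₂ (sym (F₂.ρ-index i₂ refl)))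

  C₁-class : ∀ {s} → C₁ F₁ F₂ α₁ s ⇔ κ s ≡ κ (F₁.1# , F₂.0#)
  C₁-class = mk⇔ C₁⇒ ⇒C₁
    where
    C₁⇒ : ∀ {s} → C₁ F₁ F₂ α₁ s → κ s ≡ κ (F₁.1# , F₂.0#)
    C₁⇒ (k , _ , refl) = trans
      (cong κ (sym (cong₂ _,_ (F₁.*-identityʳ _) (F₂.zeroʳ (α₂ F₂.^ k)))))
      (κ-invariant (H-powers k k refl) (F₁.1# , F₂.0#))
    ⇒C₁ : ∀ {s} → κ s ≡ κ (F₁.1# , F₂.0#) → C₁ F₁ F₂ α₁ s
    ⇒C₁ {s} eq with κ-transitive (F₁.1# , F₂.0#) s (sym eq)
    ... | (h₁ , h₂) , (h₁≢0 , _) , refl with F₁.power-below-N h₁≢0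
    ...   | k , k<N₁ , αᵏ≡h₁ =
      k , ℕ.∸-monoˡ-≤ 1 k<N₁ , cong₂ _,_ (trans (F₁.*-identityʳ h₁) (sym αᵏ≡h₁)) (F₂.zeroʳ h₂)

  D₀-class : ∀ {s} → D₀ F₁ F₂ m α₁ α₂ s ⇔ κ s ≡ κ (F₁.1# , F₂.1#)
  D₀-class = mk⇔ D₀⇒ ⇒D₀
    where
    D₀⇒ : ∀ {s} → D₀ F₁ F₂ m α₁ α₂ s → κ s ≡ κ (F₁.1# , F₂.1#)
    D₀⇒ (i₁ , i₂ , i₁≡i₂ , refl) = trans
      (cong κ (sym (cong₂ _,_ (F₁.*-identityʳ _) (F₂.*-identityʳ _))))
      (κ-invariant (H-powers i₁ i₂ i₁≡i₂) (F₁.1# , F₂.1#))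
    ⇒D₀ : ∀ {s} → κ s ≡ κ (F₁.1# , F₂.1#) → D₀ F₁ F₂ m α₁ α₂ s
    ⇒D₀ {s} eq with κ-transitive (F₁.1# , F₂.1#) s (sym eq)
    ... | (h₁ , h₂) , (h₁≢0 , h₂≢0 , ρh₁≡ρh₂) , refl with α₁-primitive h₁ h₁≢0 | α₂-primitive h₂ h₂≢0
    ...   | i₁ , αⁱ¹≡h₁ | i₂ , αⁱ²≡h₂ =
      i₁ , i₂ , trans (sym (F₁.ρ-index i₁ αⁱ¹≡h₁)) (trans ρh₁≡ρh₂ (F₂.ρ-index i₂ αⁱ²≡h₂)) ,
      cong₂ _,_ (trans (F₁.*-identityʳ h₁) (sym αⁱ¹≡h₁)) (trans (F₂.*-identityʳ h₂) (sym αⁱ²≡h₂))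

  connectionSet-closed : ∀ {s s′} → κ s ≡ κ s′ →
    C₁ F₁ F₂ α₁ s ⊎ D₀ F₁ F₂ m α₁ α₂ s → C₁ F₁ F₂ α₁ s′ ⊎ D₀ F₁ F₂ m α₁ α₂ s′
  connectionSet-closed κs≡κs′ = Sum.map
    (λ c → Equivalence.from C₁-class (trans (sym κs≡κs′) (Equivalence.to C₁-class c)))
    (λ d → Equivalence.from D₀-class (trans (sym κs≡κs′) (Equivalence.to D₀-class d)))

  Γ-isUnionOfClasses : _IsUnionOfClassesOf_ (vertices F₁ F₂) (Γ F₁ F₂ m α₁ α₂) coherentConfiguration
  Γ-isUnionOfClasses x _ x′ y′ eq (s , s∈S , refl) =
    y′ ⊖ x′ , connectionSet-closed (trans (cong κ (sym (⊕-⊖-cancelʳ s x))) eq) s∈S , sym (⊖-⊕-cancelʳ x′ y′)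

open import Data.Nat using (_+_; _*_)

corollary3p8 :
    (m n₁ n₂ q₁ q₂ : ℕ) → .{{_ : NonZero m}} → 2 ≤ m → 1 ≤ n₁ → 1 ≤ n₂ →
      q₁ ≡ 1 + m * n₁ → q₂ ≡ 1 + m * n₂ → IsPrimePower q₁ → IsPrimePower q₂ →
      (F₁ : FiniteField q₁) (F₂ : FiniteField q₂) →
      (α₁ : Fin q₁) (α₂ : Fin q₂) →
      FiniteField.Primitive F₁ α₁ → FiniteField.Primitive F₂ α₂ →
      CoherentRank≤ (vertices F₁ F₂) (Γ F₁ F₂ m α₁ α₂) (m + 3)
corollary3p8 m n₁ n₂ _ _ 2≤m 1≤n₁ 1≤n₂ refl refl _ _ F₁ F₂ _ _ α₁-primitive α₂-primitive =
  3 + m , ℕ.≤-reflexive (ℕ.+-comm 3 m) , coherentConfiguration , Γ-isUnionOfClasses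
  where
  2≤m*n : ∀ {n} → 1 ≤ n → 2 ≤ m * n
  2≤m*n {n} 1≤n = ℕ.≤-trans 2≤m (ℕ.m≤m*n m n {{ℕ.>-nonZero 1≤n}})
  open Γ-Configuration m F₁ F₂ (2≤m*n 1≤n₁) (2≤m*n 1≤n₂) (m∣m*n n₁) (m∣m*n n₂)
                      α₁-primitive α₂-primitive
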